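{- Let $v,k$ be integers with $4\leq k\leq v-4$. If $G$ and $G'$ are two graphs on the same set $V$ of $v$ vertices which are $k$-hypomorphic up to complementation, then $G'=G$ or $G'=\overline G$.
   Context: A graph is a pair $G=(V,E)$ with $E$ a set of 2-element subsets of $V$; $\overline G$ denotes its complement and $G_{\restriction K}$ the subgraph induced on $K\subseteq V$. Two graphs are isomorphic up to complementation if one is isomorphic to the other or to its complement. $G,G'$ on $V$ are $k$-hypomorphic up to complementation if for every $k$-element $K\subseteq V$, $G_{\restriction K}$ and $G'_{\restriction K}$ are isomorphic up to complementation. -}

module Defs where

open import Data.Nat using (ℕ)
open import Data.Fin using (Fin)
open import Data.Fin.Subset using (Subset; _∈_)
open import Data.Bool using (Bool; not)
open import Data.Product using (Σ; proj₁; _×_)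
open import Data.Sum using (_⊎_)
open import Relation.Binary.PropositionalEquality using (_≡_; _≢_)
open import Function.Bundles using (_↔_; Inverse)

-- The edge set is the set of 2-element subsets {x,y} (x ≢ y) with adj x y ≡ true.
-- Values adj x x on the diagonal carry no meaning and are ignored everywhere.
record Graph (v : ℕ) : Set where
  field
    adj : Fin v → Fin v → Bool
    adj-sym : ∀ x y → adj x y ≡ adj y x
open Graph public

complement : ∀ {v} → Graph v → Graph v
complement G = record
  { adj = λ x y → not (adj G x y)
  ; adj-sym = λ x y → Relation.Binary.PropositionalEquality.cong not (adj-sym G x y) }
  where import Relation.Binary.PropositionalEquality

_≐_ : ∀ {v} → Graph v → Graph v → Set
G ≐ H = ∀ x y → x ≢ y → adj G x y ≡ adj H x y

Elem : ∀ {v} → Subset v → Set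
Elem {v} K = Σ (Fin v) (λ x → x ∈ K)

IsoOn : ∀ {v} → Subset v → Graph v → Graph v → Set
IsoOn K G H = Σ (Elem K ↔ Elem K) λ σ →
  ∀ (x y : Elem K) → proj₁ x ≢ proj₁ y →
    adj G (proj₁ x) (proj₁ y) ≡ adj H (proj₁ (Inverse.to σ x)) (proj₁ (Inverse.to σ y))

IsoUpToCompOn : ∀ {v} → Subset v → Graph v → Graph v → Set
IsoUpToCompOn K G H = IsoOn K G H ⊎ IsoOn K G (complement H)

HypomorphicUpToComp : ∀ {v} → ℕ → Graph v → Graph v → Set
HypomorphicUpToComp {v} k G H =
  ∀ (K : Subset v) → Data.Fin.Subset.∣ K ∣ ≡ k → IsoUpToCompOn K G H
  where import Data.Fin.Subset

-- Four vertices span six pairs, so complementation does not change the parity of the number of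
-- edges on a 4-set. Hence if G↾K and G′↾K are isomorphic up to complementation, G and G′ have the
-- same number of ordered 4-tuples of distinct vertices of K spanning an odd number of edges: the
-- symmetric function D = oddEdges₄ G − oddEdges₄ G′ on such tuples sums to 0 over every k-set. For
-- 4 ≤ k ≤ v − 4 this forces D = 0 (a Gottlieb–Kantor type argument: by induction on the arity,
-- D does not depend on any single entry, so it is a constant, which must be 0). Thus every 4-set
-- spans an even number of edges of δ = G ⊕ G′. Then δ(u,w) is the parity of δ on any triangle
-- disjoint from {u,w}; with at least 7 vertices any two pairs avoid a common triangle, so δ is
-- empty or complete, that is G′ = G or G′ is the complement of G.

module Submission where

open import Defs
open import Data.Nat using (ℕ; _≤_; _∸_)
open import Data.Sum using (_⊎_)

open import Algebra.Bundles using (CommutativeMonoid; CommutativeRing)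
open import Data.Bool using (Bool; true; false; not; _xor_; if_then_else_)
import Data.Bool.Properties as Bool
open import Data.Empty using (⊥-elim)
open import Data.Fin using (Fin; zero; suc; _≟_)
open import Data.Fin.Permutation using (Permutation′; permutation; _⟨$⟩ʳ_; _⟨$⟩ˡ_; inverseˡ)
open import Data.Fin.Properties using (pigeonhole; ¬∀⟶∃¬; <⇒≢)
open import Data.Fin.Subset using (Subset; _∈_; ∣_∣)
open import Data.Fin.Subset.Properties using (_∈?_)
open import Data.Integer using (ℤ; +_; 0ℤ; 1ℤ; _+_; _*_; _-_; NonZero)
import Data.Integer.Properties as ℤ
open import Data.Integer.Solver using (module +-*-Solver)
open import Algebra.Properties.Semiring.Sum ℤ.+-*-semiring
  using (sum; sum-cong-≗; ∑-distrib-+; *-distribˡ-sum; sum-replicate-zero; sum-permute)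
open import Data.List as List using (List; []; _∷_; length)
open import Data.List.Relation.Unary.All using (All; []; _∷_)
open import Data.List.Relation.Unary.All.Properties using (¬Any⇒All¬)
open import Data.List.Relation.Unary.Any as Any using (Any; any?)
open import Data.List.Relation.Unary.Any.Properties using (lookup-index)
open import Data.Nat as ℕ using (zero; suc; pred; z≤n; s≤s; _<_)
import Data.Nat.Properties as ℕ
open import Data.Product using (∃; _,_; proj₁; proj₂; _×_)
open import Data.Sum as Sum using (inj₁; inj₂)
open import Data.Unit using (⊤; tt)
open import Data.Vec as Vec using (Vec; []; _∷_; here; there; lookup; tabulate)
import Data.Vec.Properties as Vec
open import Function using (_∘_; id; _↔_; Inverse)
open import Relation.Nullary using (¬_; yes; no; does; contradiction)
open import Relation.Binary.PropositionalEquality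

private variable
  n t : ℕ

-- Vertex sets as characteristic functions, compared pointwise with _≗_; the Subset n of Defs
-- enters only through lookup and tabulate.
FinSet : ℕ → Set
FinSet n = Fin n → Bool

infixl 6 _∖_ _∪⁅_⁆
infix 4 _⊆_

_∖_ : FinSet n → Fin n → FinSet n
(K ∖ x) y = if does (y ≟ x) then false else K y

_∪⁅_⁆ : FinSet n → Fin n → FinSet n
(K ∪⁅ x ⁆) y = if does (y ≟ x) then true else K y

_⊆_ : FinSet n → FinSet n → Set
K ⊆ U = ∀ x → K x ≡ true → U x ≡ true

full : FinSet n
full _ = true

size : FinSet n → ℕ
size {zero}  K = 0
size {suc n} K = (if K zero then 1 else 0) ℕ.+ size (K ∘ suc)

module _ (K : FinSet n) where

  ∖-self : ∀ x → (K ∖ x) x ≡ false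
  ∖-self x with x ≟ x
  ... | yes _   = refl
  ... | no x≢x = ⊥-elim (x≢x refl)

  ∪⁅⁆-self : ∀ x → (K ∪⁅ x ⁆) x ≡ true
  ∪⁅⁆-self x with x ≟ x
  ... | yes _   = refl
  ... | no x≢x = ⊥-elim (x≢x refl)

  ∖-other : ∀ {x y} → y ≢ x → (K ∖ x) y ≡ K y
  ∖-other {x} {y} y≢x with y ≟ x
  ... | yes y≡x = ⊥-elim (y≢x y≡x)
  ... | no _    = refl

  ∖-true : ∀ {x y} → (K ∖ x) y ≡ true → y ≢ x × K y ≡ true
  ∖-true {x} {y} Ky with y ≟ x
  ... | no y≢x = y≢x , Ky

  ∖-⊆ : ∀ x → K ∖ x ⊆ K
  ∖-⊆ x y = proj₂ ∘ ∖-true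

  ∖-∪⁅⁆ : ∀ {x} → K x ≡ false → K ∪⁅ x ⁆ ∖ x ≗ K
  ∖-∪⁅⁆ {x} Kx y with y ≟ x
  ... | yes refl = sym Kx
  ... | no _     = refl

  ∖-comm : ∀ a b → K ∖ a ∖ b ≗ K ∖ b ∖ a
  ∖-comm a b y with y ≟ a | y ≟ b
  ... | yes _ | yes _ = refl
  ... | yes _ | no _  = refl
  ... | no _  | yes _ = refl
  ... | no _  | no _  = refl

  ∪⁅⁆-∖-comm : ∀ {x z} → z ≢ x → K ∪⁅ x ⁆ ∖ z ≗ K ∖ z ∪⁅ x ⁆
  ∪⁅⁆-∖-comm {x} {z} z≢x y with y ≟ z | y ≟ x
  ... | yes refl | yes refl = ⊥-elim (z≢x refl)
  ... | yes _    | no _     = refl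
  ... | no _     | yes _    = refl
  ... | no _     | no _     = refl

∖-cong : ∀ {K K′ : FinSet n} z → K ≗ K′ → K ∖ z ≗ K′ ∖ z
∖-cong z K≗K′ y with y ≟ z
... | yes _ = refl
... | no _  = K≗K′ y

∖-mono : ∀ {K U : FinSet n} z → K ⊆ U → K ∖ z ⊆ U ∖ z
∖-mono z K⊆U y Ky with y ≟ z
... | no _ = K⊆U y Ky

∪⁅⁆-⊆ : ∀ {K U : FinSet n} {x} → K ⊆ U → U x ≡ true → K ∪⁅ x ⁆ ⊆ U
∪⁅⁆-⊆ {x = x} K⊆U Ux y Ky with y ≟ x
... | yes refl = Ux
... | no _     = K⊆U y Ky

⊆-false : ∀ {K U : FinSet n} {x} → K ⊆ U → U x ≡ false → K x ≡ false
⊆-false {K = K} {x = x} K⊆U Ux with K x in Kx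
... | false = refl
... | true  = contradiction (trans (sym (K⊆U x Kx)) Ux) λ ()

size-full : ∀ n → size (full {n}) ≡ n
size-full zero    = refl
size-full (suc n) = cong suc (size-full n)

size-tabulate : ∀ (K : FinSet n) → ∣ tabulate K ∣ ≡ size K
size-tabulate {zero}  K = refl
size-tabulate {suc n} K with K zero
... | true  = cong suc (size-tabulate (K ∘ suc))
... | false = size-tabulate (K ∘ suc)

size-cong : ∀ {K K′ : FinSet n} → K ≗ K′ → size K ≡ size K′
size-cong {zero}  K≗K′ = refl
size-cong {suc n} K≗K′ rewrite K≗K′ zero = cong (_ ℕ.+_) (size-cong (K≗K′ ∘ suc))

size-∖ : ∀ (K : FinSet n) {x} → K x ≡ true → size K ≡ suc (size (K ∖ x))
size-∖ {suc n} K {zero}  Kx rewrite Kx = refl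
size-∖ {suc n} K {suc x} Kx with K zero
... | true  = cong suc (size-∖ (K ∘ suc) Kx)
... | false = size-∖ (K ∘ suc) Kx

size-∪⁅⁆ : ∀ (K : FinSet n) {x} → K x ≡ false → size (K ∪⁅ x ⁆) ≡ suc (size K)
size-∪⁅⁆ K {x} Kx = trans (size-∖ (K ∪⁅ x ⁆) (∪⁅⁆-self K x)) (cong suc (size-cong (∖-∪⁅⁆ K Kx)))

true-false-≢ : ∀ {K : FinSet n} {x y} → K x ≡ true → K y ≡ false → x ≢ y
true-false-≢ Kx Ky refl = contradiction (trans (sym Kx) Ky) λ ()

∃-member : ∀ (K : FinSet n) → 0 < size K → ∃ λ x → K x ≡ true
∃-member {suc n} K 0<∣K∣ with K zero in K0
... | true  = zero , K0
... | false = let x , Kx = ∃-member (K ∘ suc) 0<∣K∣ in suc x , Kx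

subset-of-size : ∀ (U : FinSet n) {k} → k ≤ size U → ∃ λ K → K ⊆ U × size K ≡ k
subset-of-size {n} U {k} k≤∣U∣ = go (size U ∸ k) U (sym (ℕ.m+[n∸m]≡n k≤∣U∣))
  where
  go : ∀ d (U : FinSet n) → size U ≡ k ℕ.+ d → ∃ λ K → K ⊆ U × size K ≡ k
  go zero    U ∣U∣≡k   = U , (λ _ → id) , trans ∣U∣≡k (ℕ.+-identityʳ k)
  go (suc d) U ∣U∣≡k+d =
    let ∣U∣≡1+k+d  = trans ∣U∣≡k+d (ℕ.+-suc k d)
        x , Ux     = ∃-member U (subst (0 <_) (sym ∣U∣≡1+k+d) (s≤s z≤n))
        K , K⊆U∖x , ∣K∣≡k = go d (U ∖ x) (ℕ.suc-injective (trans (sym (size-∖ U Ux)) ∣U∣≡1+k+d))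
    in K , (λ y → ∖-⊆ U x y ∘ K⊆U∖x y) , ∣K∣≡k

-- Sums over tuples of distinct elements

fallingFactorial : ℕ → ℕ → ℕ
fallingFactorial m zero    = 1
fallingFactorial m (suc t) = m ℕ.* fallingFactorial (pred m) t

fallingFactorial-nonZero : ∀ {m t} → t ≤ m → ℕ.NonZero (fallingFactorial m t)
fallingFactorial-nonZero {t = zero}  _          = _
fallingFactorial-nonZero {suc m} {suc t} (s≤s t≤m) =
  ℕ.m*n≢0 (suc m) (fallingFactorial m t) {{_}} {{fallingFactorial-nonZero t≤m}}

infixr 8 [_]×_

[_]×_ : Bool → ℤ → ℤ
[ b ]× a = if b then a else 0ℤ

[]×-cong : ∀ {b a a′} → (b ≡ true → a ≡ a′) → [ b ]× a ≡ [ b ]× a′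
[]×-cong {true}  a≡a′ = a≡a′ refl
[]×-cong {false} _    = refl

[]×-+ : ∀ b a a′ → [ b ]× (a + a′) ≡ [ b ]× a + [ b ]× a′
[]×-+ true  a a′ = refl
[]×-+ false a a′ = refl

[]×-- : ∀ b a a′ → [ b ]× (a - a′) ≡ [ b ]× a - [ b ]× a′
[]×-- true  a a′ = refl
[]×-- false a a′ = refl

[]×-* : ∀ b c a → [ b ]× (c * a) ≡ c * [ b ]× a
[]×-* true  c a = refl
[]×-* false c a = sym (ℤ.*-zeroʳ c)

[]×1-injective : ∀ {b b′} → [ b ]× 1ℤ ≡ [ b′ ]× 1ℤ → b ≡ b′
[]×1-injective {false} {false} _ = refl
[]×1-injective {true}  {true}  _ = refl

sum-- : ∀ (f g : Fin n → ℤ) → sum (λ z → f z - g z) ≡ sum f - sum g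
sum-- {zero}  f g = refl
sum-- {suc n} f g rewrite sum-- (f ∘ suc) (g ∘ suc) =
  solve 4 (λ a b c d → (a :- b) :+ (c :- d) := (a :+ c) :- (b :+ d)) refl
    (f zero) (g zero) (sum (f ∘ suc)) (sum (g ∘ suc))
  where open +-*-Solver

sum-point : ∀ x (f : Fin n → ℤ) → sum (λ z → [ does (z ≟ x) ]× f z) ≡ f x
sum-point {suc n} zero    f = trans (cong (λ s → f zero + s) (sum-replicate-zero n)) (ℤ.+-identityʳ _)
sum-point {suc n} (suc x) f = trans (ℤ.+-identityˡ _) (sum-point x (f ∘ suc))

sum-[]×-const : ∀ (K : FinSet n) c → sum (λ z → [ K z ]× c) ≡ + size K * c
sum-[]×-const {zero}  K c = refl
sum-[]×-const {suc n} K c with K zero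
... | true  rewrite sum-[]×-const (K ∘ suc) c = sym (begin
  + suc m * c          ≡⟨ cong (_* c) (ℤ.pos-+ 1 m) ⟩
  (1ℤ + + m) * c       ≡⟨ ℤ.*-distribʳ-+ c 1ℤ (+ m) ⟩
  1ℤ * c + + m * c     ≡⟨ cong (_+ + m * c) (ℤ.*-identityˡ c) ⟩
  c + + m * c          ∎)
  where
  open ≡-Reasoning
  m = size (K ∘ suc)
... | false rewrite sum-[]×-const (K ∘ suc) c = ℤ.+-identityˡ _

DistinctIn : FinSet n → Vec (Fin n) t → Set
DistinctIn K []      = ⊤
DistinctIn K (x ∷ w) = K x ≡ true × DistinctIn (K ∖ x) w

DistinctIn-cong : ∀ {K K′ : FinSet n} → K ≗ K′ → (w : Vec (Fin n) t) → DistinctIn K w → DistinctIn K′ w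
DistinctIn-cong K≗K′ []      _          = tt
DistinctIn-cong K≗K′ (x ∷ w) (Kx , dw) = trans (sym (K≗K′ x)) Kx , DistinctIn-cong (∖-cong x K≗K′) w dw

DistinctIn-mono : ∀ {K U : FinSet n} → K ⊆ U → (w : Vec (Fin n) t) → DistinctIn K w → DistinctIn U w
DistinctIn-mono K⊆U []      _          = tt
DistinctIn-mono K⊆U (x ∷ w) (Kx , dw) = K⊆U x Kx , DistinctIn-mono (∖-mono x K⊆U) w dw

sumDistinct : ∀ t → FinSet n → (Vec (Fin n) t → ℤ) → ℤ
sumDistinct zero    K F = F []
sumDistinct (suc t) K F = sum λ z → [ K z ]× sumDistinct t (K ∖ z) (F ∘ (z ∷_))

-- Swapping the first two entries, at every depth: adjacent transpositions generate all permutations.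
Symmetric : ∀ t → (Vec (Fin n) t → ℤ) → Set
Symmetric zero          F = ⊤
Symmetric (suc zero)    F = ⊤
Symmetric (suc (suc t)) F =
  (∀ a b w → F (a ∷ b ∷ w) ≡ F (b ∷ a ∷ w)) × (∀ a → Symmetric (suc t) (F ∘ (a ∷_)))

Symmetric-tail : ∀ t {F : Vec (Fin n) (suc t) → ℤ} → Symmetric (suc t) F → ∀ a → Symmetric t (F ∘ (a ∷_))
Symmetric-tail zero    _          _ = tt
Symmetric-tail (suc t) (_ , symF) a = symF a

Symmetric-- : ∀ t {F G : Vec (Fin n) t → ℤ} → Symmetric t F → Symmetric t G → Symmetric t (λ w → F w - G w)
Symmetric-- zero          _              _              = tt
Symmetric-- (suc zero)    _              _              = tt
Symmetric-- (suc (suc t)) (swF , symF) (swG , symG) =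
  (λ a b w → cong₂ _-_ (swF a b w) (swG a b w)) , (λ a → Symmetric-- (suc t) (symF a) (symG a))

sumDistinct-cong : ∀ t (K : FinSet n) {F G : Vec (Fin n) t → ℤ} →
  (∀ w → DistinctIn K w → F w ≡ G w) → sumDistinct t K F ≡ sumDistinct t K G
sumDistinct-cong zero    K F≡G = F≡G [] tt
sumDistinct-cong (suc t) K F≡G = sum-cong-≗ λ z →
  []×-cong λ Kz → sumDistinct-cong t (K ∖ z) λ w dw → F≡G (z ∷ w) (Kz , dw)

sumDistinct-congˡ : ∀ t {K K′ : FinSet n} (F : Vec (Fin n) t → ℤ) → K ≗ K′ →
  sumDistinct t K F ≡ sumDistinct t K′ F
sumDistinct-congˡ zero    F K≗K′ = refl
sumDistinct-congˡ (suc t) F K≗K′ = sum-cong-≗ λ z →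
  cong₂ [_]×_ (K≗K′ z) (sumDistinct-congˡ t (F ∘ (z ∷_)) (∖-cong z K≗K′))

sumDistinct-- : ∀ t (K : FinSet n) (F G : Vec (Fin n) t → ℤ) →
  sumDistinct t K (λ w → F w - G w) ≡ sumDistinct t K F - sumDistinct t K G
sumDistinct-- zero    K F G = refl
sumDistinct-- (suc t) K F G = trans
  (sum-cong-≗ λ z → trans (cong [ K z ]×_ (sumDistinct-- t (K ∖ z) (F ∘ (z ∷_)) (G ∘ (z ∷_)))) ([]×-- (K z) _ _))
  (sum-- (λ z → [ K z ]× tails F z) (λ z → [ K z ]× tails G z))
  where
  tails : (Vec (Fin _) (suc t) → ℤ) → Fin _ → ℤ
  tails H z = sumDistinct t (K ∖ z) (H ∘ (z ∷_))

sumDistinct-const : ∀ t (K : FinSet n) {F : Vec (Fin n) t → ℤ} c →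
  (∀ w → DistinctIn K w → F w ≡ c) → sumDistinct t K F ≡ c * + fallingFactorial (size K) t
sumDistinct-const zero    K c F≡c = trans (F≡c [] tt) (sym (ℤ.*-identityʳ c))
sumDistinct-const (suc t) K {F} c F≡c = begin
  sum (λ z → [ K z ]× sumDistinct t (K ∖ z) (F ∘ (z ∷_)))
    ≡⟨ sum-cong-≗ (λ z → []×-cong (tail-sum z)) ⟩
  sum (λ z → [ K z ]× (c * + m))
    ≡⟨ sum-[]×-const K (c * + m) ⟩
  + size K * (c * + m)
    ≡⟨ solve 3 (λ k c m → k :* (c :* m) := c :* (k :* m)) refl (+ size K) c (+ m) ⟩
  c * (+ size K * + m)
    ≡⟨ cong (c *_) (ℤ.pos-* (size K) m) ⟨
  c * + fallingFactorial (size K) (suc t) ∎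
  where
  open ≡-Reasoning
  open +-*-Solver
  m = fallingFactorial (pred (size K)) t
  tail-sum : ∀ z → K z ≡ true → sumDistinct t (K ∖ z) (F ∘ (z ∷_)) ≡ c * + m
  tail-sum z Kz = trans (sumDistinct-const t (K ∖ z) c (λ w dw → F≡c (z ∷ w) (Kz , dw)))
                        (cong (λ k → c * + fallingFactorial (pred k) t) (sym (size-∖ K Kz)))

-- By symmetry of F, each of the t + 1 positions that x can take contributes sumDistinct t K (F ∘ (x ∷_)).
sumDistinct-∪⁅⁆ : ∀ t (K : FinSet n) {x} (F : Vec (Fin n) (suc t) → ℤ) →
  Symmetric (suc t) F → K x ≡ false →
  sumDistinct (suc t) (K ∪⁅ x ⁆) F ≡ sumDistinct (suc t) K F + + suc t * sumDistinct t K (F ∘ (x ∷_))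

sum-heads-∪⁅⁆ : ∀ t (K : FinSet n) {x} (F : Vec (Fin n) (suc t) → ℤ) →
  Symmetric (suc t) F → K x ≡ false →
  sum (λ z → [ K z ]× sumDistinct t (K ∖ z ∪⁅ x ⁆) (F ∘ (z ∷_)))
    ≡ sumDistinct (suc t) K F + + t * sumDistinct t K (F ∘ (x ∷_))

sumDistinct-∪⁅⁆ t K {x} F symF Kx = begin
  sum (λ z → [ (K ∪⁅ x ⁆) z ]× A z)
    ≡⟨ sum-cong-≗ split ⟩
  sum (λ z → [ does (z ≟ x) ]× A z + [ K z ]× A z)
    ≡⟨ ∑-distrib-+ (λ z → [ does (z ≟ x) ]× A z) (λ z → [ K z ]× A z) ⟩
  sum (λ z → [ does (z ≟ x) ]× A z) + sum (λ z → [ K z ]× A z)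
    ≡⟨ cong₂ _+_ (sum-point x A) (sum-cong-≗ λ z → []×-cong λ Kz →
         sumDistinct-congˡ t (F ∘ (z ∷_)) (∪⁅⁆-∖-comm K (true-false-≢ Kz Kx))) ⟩
  A x + sum (λ z → [ K z ]× sumDistinct t (K ∖ z ∪⁅ x ⁆) (F ∘ (z ∷_)))
    ≡⟨ cong₂ _+_ (sumDistinct-congˡ t (F ∘ (x ∷_)) (∖-∪⁅⁆ K Kx)) (sum-heads-∪⁅⁆ t K F symF Kx) ⟩
  P + (S + + t * P)
    ≡⟨ solve 3 (λ p s c → p :+ (s :+ c :* p) := s :+ (con 1ℤ :+ c) :* p) refl P S (+ t) ⟩
  S + + suc t * P ∎
  where
  open ≡-Reasoning
  open +-*-Solver
  A : Fin _ → ℤ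
  A z = sumDistinct t (K ∪⁅ x ⁆ ∖ z) (F ∘ (z ∷_))
  P = sumDistinct t K (F ∘ (x ∷_))
  S = sumDistinct (suc t) K F
  split : ∀ z → [ (K ∪⁅ x ⁆) z ]× A z ≡ [ does (z ≟ x) ]× A z + [ K z ]× A z
  split z with z ≟ x
  ... | yes refl rewrite Kx = sym (ℤ.+-identityʳ _)
  ... | no _     = sym (ℤ.+-identityˡ _)

sum-heads-∪⁅⁆ zero K {x} F _ Kx =
  sym (trans (cong (λ p → sumDistinct 1 K F + p) (ℤ.*-zeroˡ (F (x ∷ [])))) (ℤ.+-identityʳ _))
sum-heads-∪⁅⁆ (suc t) K {x} F (swapF , symF) Kx = begin
  sum (λ z → [ K z ]× sumDistinct (suc t) (K ∖ z ∪⁅ x ⁆) (F ∘ (z ∷_)))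
    ≡⟨ sum-cong-≗ (λ z → []×-cong (insert-in-tail z)) ⟩
  sum (λ z → [ K z ]× (S z + c * Q z))
    ≡⟨ sum-cong-≗ (λ z → trans ([]×-+ (K z) _ _) (cong (λ q → [ K z ]× S z + q) ([]×-* (K z) c (Q z)))) ⟩
  sum (λ z → [ K z ]× S z + c * [ K z ]× Q z)
    ≡⟨ ∑-distrib-+ (λ z → [ K z ]× S z) (λ z → c * [ K z ]× Q z) ⟩
  sumDistinct (suc (suc t)) K F + sum (λ z → c * [ K z ]× Q z)
    ≡⟨ cong (λ q → sumDistinct (suc (suc t)) K F + q) (*-distribˡ-sum c (λ z → [ K z ]× Q z)) ⟨
  sumDistinct (suc (suc t)) K F + c * sumDistinct (suc t) K (F ∘ (x ∷_)) ∎
  where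
  open ≡-Reasoning
  c = + suc t
  S Q : Fin _ → ℤ
  S z = sumDistinct (suc t) (K ∖ z) (F ∘ (z ∷_))
  Q z = sumDistinct t (K ∖ z) (F ∘ (x ∷_) ∘ (z ∷_))
  insert-in-tail : ∀ z → K z ≡ true → sumDistinct (suc t) (K ∖ z ∪⁅ x ⁆) (F ∘ (z ∷_)) ≡ S z + c * Q z
  insert-in-tail z Kz = trans
    (sumDistinct-∪⁅⁆ t (K ∖ z) (F ∘ (z ∷_)) (symF z) (trans (∖-other K (true-false-≢ Kz Kx ∘ sym)) Kx))
    (cong (λ q → S z + c * q) (sumDistinct-cong t (K ∖ z) λ w _ → swapF z x w))

sumDistinct-permute : ∀ t (π : Permutation′ n) (K K′ : FinSet n) (F : Vec (Fin n) t → ℤ) →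
  K′ ≗ K ∘ (π ⟨$⟩ʳ_) → sumDistinct t K F ≡ sumDistinct t K′ (F ∘ Vec.map (π ⟨$⟩ʳ_))
sumDistinct-permute zero    π K K′ F K′≗Kπ = refl
sumDistinct-permute (suc t) π K K′ F K′≗Kπ = trans
  (sum-permute (λ z → [ K z ]× sumDistinct t (K ∖ z) (F ∘ (z ∷_))) π)
  (sum-cong-≗ λ z → cong₂ [_]×_ (sym (K′≗Kπ z))
    (sumDistinct-permute t π (K ∖ (π ⟨$⟩ʳ z)) (K′ ∖ z) (F ∘ ((π ⟨$⟩ʳ z) ∷_)) (remove-π z)))
  where
  remove-π : ∀ z y → (K′ ∖ z) y ≡ (K ∖ (π ⟨$⟩ʳ z)) (π ⟨$⟩ʳ y)
  remove-π z y with y ≟ z | (π ⟨$⟩ʳ y) ≟ (π ⟨$⟩ʳ z)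
  ... | yes _    | yes _   = refl
  ... | yes refl | no πy≢πy = ⊥-elim (πy≢πy refl)
  ... | no y≢z   | yes πy≡πz =
    ⊥-elim (y≢z (trans (sym (inverseˡ π)) (trans (cong (π ⟨$⟩ˡ_) πy≡πz) (inverseˡ π))))
  ... | no _     | no _    = K′≗Kπ y

-- Symmetric functions whose sums over all k-sets vanish

HeadInvariant : FinSet n → (Vec (Fin n) (suc t) → ℤ) → Set
HeadInvariant {n} {t} U F = ∀ {x y} → U x ≡ true → U y ≡ true → x ≢ y →
  (w : Vec (Fin n) t) → DistinctIn (U ∖ x ∖ y) w → F (x ∷ w) ≡ F (y ∷ w)

HeadInvariant-tail : ∀ {U : FinSet n} {F : Vec (Fin n) (suc (suc t)) → ℤ} →
  Symmetric (suc (suc t)) F → HeadInvariant U F → ∀ {a} → U a ≡ true → HeadInvariant (U ∖ a) (F ∘ (a ∷_))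
HeadInvariant-tail {U = U} {F} (swapF , _) invF {a} Ua {x} {y} U∖a-x U∖a-y x≢y w dw = begin
  F (a ∷ x ∷ w)  ≡⟨ swapF a x w ⟩
  F (x ∷ a ∷ w)  ≡⟨ invF Ux Uy x≢y (a ∷ w) (a∈U∖x∖y , DistinctIn-cong reorder w dw) ⟩
  F (y ∷ a ∷ w)  ≡⟨ swapF y a w ⟩
  F (a ∷ y ∷ w)  ∎
  where
  open ≡-Reasoning
  Ux = proj₂ (∖-true U U∖a-x)
  Uy = proj₂ (∖-true U U∖a-y)
  a∈U∖x∖y : (U ∖ x ∖ y) a ≡ true
  a∈U∖x∖y = trans (∖-other (U ∖ x) (proj₁ (∖-true U U∖a-y) ∘ sym))
                  (trans (∖-other U (proj₁ (∖-true U U∖a-x) ∘ sym)) Ua)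
  reorder : U ∖ a ∖ x ∖ y ≗ U ∖ x ∖ y ∖ a
  reorder z = trans (∖-cong y (∖-comm U a x) z) (∖-comm (U ∖ x) a y z)

-- In the second case b occurs in u, and r is u with b deleted.
DistinctIn-avoid-or-drop : ∀ (K : FinSet n) b (u : Vec (Fin n) (suc t)) → DistinctIn K u →
  DistinctIn (K ∖ b) u ⊎ ∃ λ (r : Vec (Fin n) t) → DistinctIn (K ∖ b) r
DistinctIn-avoid-or-drop K b (c ∷ u) (Kc , du) with c ≟ b
... | yes refl = inj₂ (u , du)
DistinctIn-avoid-or-drop {t = zero}  K b (c ∷ []) (Kc , _) | no c≢b = inj₁ (Kc , tt)
DistinctIn-avoid-or-drop {t = suc t} K b (c ∷ u) (Kc , du) | no c≢b
  with DistinctIn-avoid-or-drop (K ∖ c) b u du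
... | inj₁ du′      = inj₁ (Kc , DistinctIn-cong (∖-comm K c b) u du′)
... | inj₂ (r , dr) = inj₂ (c ∷ r , trans (∖-other K c≢b) Kc , DistinctIn-cong (∖-comm K c b) r dr)

HeadInvariant⇒constant : ∀ t {U : FinSet n} {F : Vec (Fin n) (suc t) → ℤ} →
  Symmetric (suc t) F → HeadInvariant U F → ∀ w w′ → DistinctIn U w → DistinctIn U w′ → F w ≡ F w′

HeadInvariant⇒tail-constant : ∀ t {U : FinSet n} {F : Vec (Fin n) (suc (suc t)) → ℤ} →
  Symmetric (suc (suc t)) F → HeadInvariant U F → ∀ {c} → U c ≡ true →
  ∀ v v′ → DistinctIn (U ∖ c) v → DistinctIn (U ∖ c) v′ → F (c ∷ v) ≡ F (c ∷ v′)
HeadInvariant⇒tail-constant t {U} {F} symF invF {c} Uc =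
  HeadInvariant⇒constant t (proj₂ symF c) (HeadInvariant-tail {U = U} {F} symF invF Uc)

HeadInvariant⇒constant zero _ invF (a ∷ []) (b ∷ []) (Ua , _) (Ub , _) with a ≟ b
... | yes refl = refl
... | no a≢b  = invF Ua Ub a≢b [] tt
HeadInvariant⇒constant (suc t) {U} {F} symF invF (a ∷ u) (b ∷ u′) (Ua , du) (Ub , du′) with a ≟ b
... | yes refl = HeadInvariant⇒tail-constant t {U} {F} symF invF Ua u u′ du du′
... | no a≢b with DistinctIn-avoid-or-drop (U ∖ a) b u du
...   | inj₁ du∖b = trans (invF Ua Ub a≢b u du∖b)
          (HeadInvariant⇒tail-constant t {U} {F} symF invF Ub u u′
             (DistinctIn-mono (∖-mono b (∖-⊆ U a)) u du∖b) du′)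
...   | inj₂ (r , dr) = begin
          F (a ∷ u)      ≡⟨ HeadInvariant⇒tail-constant t {U} {F} symF invF Ua u (b ∷ r) du
                              (trans (∖-other U (a≢b ∘ sym)) Ub , dr) ⟩
          F (a ∷ b ∷ r)  ≡⟨ proj₁ symF a b r ⟩
          F (b ∷ a ∷ r)  ≡⟨ HeadInvariant⇒tail-constant t {U} {F} symF invF Ub (a ∷ r) u′
                              (trans (∖-other U a≢b) Ua , DistinctIn-cong (∖-comm U a b) r dr) du′ ⟩
          F (b ∷ u′)     ∎
  where open ≡-Reasoning

VanishingSums : ℕ → FinSet n → ∀ t → (Vec (Fin n) t → ℤ) → Set
VanishingSums k U t F = ∀ K → K ⊆ U → size K ≡ k → sumDistinct t K F ≡ 0ℤ

cancel-common-term : ∀ a c p q .{{_ : NonZero c}} → a + c * p ≡ 0ℤ → a + c * q ≡ 0ℤ → p - q ≡ 0ℤ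
cancel-common-term a c p q a+cp≡0 a+cq≡0 = ℤ.*-cancelˡ-≡ c (p - q) 0ℤ (begin
  c * (p - q)
    ≡⟨ solve 4 (λ a c p q → c :* (p :- q) := (a :+ c :* p) :- (a :+ c :* q)) refl a c p q ⟩
  (a + c * p) - (a + c * q)
    ≡⟨ cong₂ _-_ a+cp≡0 a+cq≡0 ⟩
  0ℤ
    ≡⟨ ℤ.*-zeroʳ c ⟨
  c * 0ℤ ∎)
  where
  open ≡-Reasoning
  open +-*-Solver

VanishingSums-head-difference : ∀ {k t} {U : FinSet n} {F : Vec (Fin n) (suc t) → ℤ} →
  Symmetric (suc t) F → VanishingSums (suc k) U (suc t) F → ∀ {x y} → U x ≡ true → U y ≡ true → x ≢ y →
  VanishingSums k (U ∖ x ∖ y) t (λ w → F (x ∷ w) - F (y ∷ w))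
VanishingSums-head-difference {k = k} {t} {U} {F} symF vanish {x} {y} Ux Uy x≢y K K⊆U∖x∖y ∣K∣≡k =
  trans (sumDistinct-- t K (F ∘ (x ∷_)) (F ∘ (y ∷_)))
        (cancel-common-term (sumDistinct (suc t) K F) (+ suc t) _ _ (adding x Kx Ux) (adding y Ky Uy))
  where
  K⊆U : K ⊆ U
  K⊆U z = ∖-⊆ U x z ∘ ∖-⊆ (U ∖ x) y z ∘ K⊆U∖x∖y z
  Kx : K x ≡ false
  Kx = ⊆-false K⊆U∖x∖y (trans (∖-other (U ∖ x) x≢y) (∖-self U x))
  Ky : K y ≡ false
  Ky = ⊆-false K⊆U∖x∖y (∖-self (U ∖ x) y)
  adding : ∀ z → K z ≡ false → U z ≡ true →
    sumDistinct (suc t) K F + + suc t * sumDistinct t K (F ∘ (z ∷_)) ≡ 0ℤ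
  adding z Kz Uz = trans (sym (sumDistinct-∪⁅⁆ t K F symF Kz))
    (vanish (K ∪⁅ z ⁆) (∪⁅⁆-⊆ K⊆U Uz) (trans (size-∪⁅⁆ K Kz) (cong suc ∣K∣≡k)))

constant-vanishing-sums⇒vanishing : ∀ {t k} (U : FinSet n) {F : Vec (Fin n) t → ℤ} → t ≤ k → k ≤ size U →
  VanishingSums k U t F → (∀ u u′ → DistinctIn U u → DistinctIn U u′ → F u ≡ F u′) →
  ∀ w → DistinctIn U w → F w ≡ 0ℤ
constant-vanishing-sums⇒vanishing {t = t} {k} U {F} t≤k k≤∣U∣ vanish constant w dw
  with subset-of-size U k≤∣U∣
... | K , K⊆U , ∣K∣≡k = ℤ.*-cancelʳ-≡ (F w) 0ℤ (+ N) {{N≢0}} (begin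
  F w * + N          ≡⟨ sumDistinct-const t K (F w) (λ u du → constant u w (DistinctIn-mono K⊆U u du) dw) ⟨
  sumDistinct t K F  ≡⟨ vanish K K⊆U ∣K∣≡k ⟩
  0ℤ                 ≡⟨ ℤ.*-zeroˡ (+ N) ⟨
  0ℤ * + N           ∎)
  where
  open ≡-Reasoning
  N = fallingFactorial (size K) t
  N≢0 : ℕ.NonZero N
  N≢0 = fallingFactorial-nonZero (subst (t ≤_) (sym ∣K∣≡k) t≤k)

vanishing-sums⇒vanishing : ∀ t k (U : FinSet n) {F : Vec (Fin n) t → ℤ} → Symmetric t F →
  t ≤ k → k ℕ.+ t ≤ size U → VanishingSums k U t F → ∀ w → DistinctIn U w → F w ≡ 0ℤ
vanishing-sums⇒vanishing zero k U _ z≤n k+0≤∣U∣ vanish =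
  constant-vanishing-sums⇒vanishing U z≤n (subst (_≤ size U) (ℕ.+-identityʳ k) k+0≤∣U∣) vanish
    λ { [] [] _ _ → refl }
vanishing-sums⇒vanishing (suc t) (suc k) U {F} symF t+1≤k+1@(s≤s t≤k) k+t≤∣U∣ vanish =
  constant-vanishing-sums⇒vanishing U t+1≤k+1 (ℕ.≤-trans (ℕ.m≤m+n (suc k) (suc t)) k+t≤∣U∣) vanish
    (HeadInvariant⇒constant t symF headInvariant)
  where
  headInvariant : HeadInvariant U F
  headInvariant {x} {y} Ux Uy x≢y u du = ℤ.i-j≡0⇒i≡j _ _
    (vanishing-sums⇒vanishing t k (U ∖ x ∖ y)
       (Symmetric-- t (Symmetric-tail t symF x) (Symmetric-tail t symF y)) t≤k k+t≤∣U∖x∖y∣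
       (VanishingSums-head-difference symF vanish Ux Uy x≢y) u du)
    where
    k+t≤∣U∖x∖y∣ : k ℕ.+ t ≤ size (U ∖ x ∖ y)
    k+t≤∣U∖x∖y∣ = ℕ.≤-pred (ℕ.≤-pred (subst₂ _≤_ (cong suc (ℕ.+-suc k t))
      (trans (size-∖ U Ux) (cong suc (size-∖ (U ∖ x) (trans (∖-other U (x≢y ∘ sym)) Uy)))) k+t≤∣U∣))

-- Graphs with an even number of edges on every 4-set

fresh : ∀ (xs : List (Fin n)) → length xs < n → ∃ λ y → All (y ≢_) xs
fresh {n} xs ∣xs∣<n =
  let y , y∉xs = ¬∀⟶∃¬ n (λ y → Any (y ≡_) xs) (λ y → any? (y ≟_) xs) xs-not-everything
  in y , ¬Any⇒All¬ xs y∉xs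
  where
  xs-not-everything : ¬ (∀ y → Any (y ≡_) xs)
  xs-not-everything y∈xs with pigeonhole ∣xs∣<n (λ y → Any.index (y∈xs y))
  ... | i , j , i<j , same-index = <⇒≢ i<j (begin
    i                                       ≡⟨ lookup-index (y∈xs i) ⟩
    List.lookup xs (Any.index (y∈xs i))     ≡⟨ cong (List.lookup xs) same-index ⟩
    List.lookup xs (Any.index (y∈xs j))     ≡⟨ lookup-index (y∈xs j) ⟨
    j                                       ∎)
    where open ≡-Reasoning

xor-commutativeMonoid : CommutativeMonoid _ _
xor-commutativeMonoid = CommutativeRing.+-commutativeMonoid Bool.xor-∧-commutativeRing

open import Algebra.Solver.CommutativeMonoid xor-commutativeMonoid using (_⊕_; _⊜_) renaming (solve to solve-xor)

xor≡false⇒≡ : ∀ {a b} → a xor b ≡ false → a ≡ b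
xor≡false⇒≡ {false} {false} _ = refl
xor≡false⇒≡ {true}  {true}  _ = refl

xor≡true⇒≡not : ∀ {a b} → a xor b ≡ true → b ≡ not a
xor≡true⇒≡not {false} {true}  _ = refl
xor≡true⇒≡not {true}  {false} _ = refl

Distinct₄ : Fin n → Fin n → Fin n → Fin n → Set
Distinct₄ a b c d = a ≢ b × a ≢ c × a ≢ d × b ≢ c × b ≢ d × c ≢ d

parity₄ : (Fin n → Fin n → Bool) → Fin n → Fin n → Fin n → Fin n → Bool
parity₄ r a b c d = r a b xor r a c xor r a d xor r b c xor r b d xor r c d

parity₄-xor : ∀ (r s : Fin n → Fin n → Bool) a b c d →
  parity₄ (λ x y → r x y xor s x y) a b c d ≡ parity₄ r a b c d xor parity₄ s a b c d
parity₄-xor r s a b c d = solve-xor 12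
  (λ ab ac ad bc bd cd ab′ ac′ ad′ bc′ bd′ cd′ →
    (ab ⊕ ab′) ⊕ (ac ⊕ ac′) ⊕ (ad ⊕ ad′) ⊕ (bc ⊕ bc′) ⊕ (bd ⊕ bd′) ⊕ (cd ⊕ cd′)
      ⊜ (ab ⊕ ac ⊕ ad ⊕ bc ⊕ bd ⊕ cd) ⊕ (ab′ ⊕ ac′ ⊕ ad′ ⊕ bc′ ⊕ bd′ ⊕ cd′))
  refl (r a b) (r a c) (r a d) (r b c) (r b d) (r c d) (s a b) (s a c) (s a d) (s b c) (s b d) (s c d)

-- not b is true xor b, and six trues cancel.
parity₄-not : ∀ (r : Fin n → Fin n → Bool) a b c d →
  parity₄ (λ x y → not (r x y)) a b c d ≡ parity₄ r a b c d
parity₄-not r = parity₄-xor (λ _ _ → true) r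

module _ {r : Fin n → Fin n → Bool} (r-sym : ∀ x y → r x y ≡ r y x) (a b c d : Fin n) where

  parity₄-swap₁₂ : parity₄ r a b c d ≡ parity₄ r b a c d
  parity₄-swap₁₂ = trans
    (solve-xor 6 (λ ab ac ad bc bd cd → ab ⊕ ac ⊕ ad ⊕ bc ⊕ bd ⊕ cd ⊜ ab ⊕ bc ⊕ bd ⊕ ac ⊕ ad ⊕ cd) refl
       (r a b) (r a c) (r a d) (r b c) (r b d) (r c d))
    (cong (λ ba → ba xor r b c xor r b d xor r a c xor r a d xor r c d) (r-sym a b))

  parity₄-swap₂₃ : parity₄ r a b c d ≡ parity₄ r a c b d
  parity₄-swap₂₃ = trans
    (solve-xor 6 (λ ab ac ad bc bd cd → ab ⊕ ac ⊕ ad ⊕ bc ⊕ bd ⊕ cd ⊜ ac ⊕ ab ⊕ ad ⊕ bc ⊕ cd ⊕ bd) refl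
       (r a b) (r a c) (r a d) (r b c) (r b d) (r c d))
    (cong (λ cb → r a c xor r a b xor r a d xor cb xor r c d xor r b d) (r-sym b c))

  parity₄-swap₃₄ : parity₄ r a b c d ≡ parity₄ r a b d c
  parity₄-swap₃₄ = trans
    (solve-xor 6 (λ ab ac ad bc bd cd → ab ⊕ ac ⊕ ad ⊕ bc ⊕ bd ⊕ cd ⊜ ab ⊕ ad ⊕ ac ⊕ bd ⊕ bc ⊕ cd) refl
       (r a b) (r a c) (r a d) (r b c) (r b d) (r c d))
    (cong (λ dc → r a b xor r a d xor r a c xor r b d xor r b c xor dc) (r-sym c d))

Even₄ : (Fin n → Fin n → Bool) → Set
Even₄ {n} r = ∀ {a b c d : Fin n} → Distinct₄ a b c d → parity₄ r a b c d ≡ false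

-- Adding up the three quadruples x y u w, x z u w and y z u w counts every edge
-- at u or w twice, so r u w is forced by the triangle x y z.
even₄-triangle : ∀ {r : Fin n → Fin n → Bool} → Even₄ r → ∀ {x y z u w} →
  x ≢ y → x ≢ z → y ≢ z → u ≢ w → x ≢ u → x ≢ w → y ≢ u → y ≢ w → z ≢ u → z ≢ w →
  r u w ≡ r x y xor r x z xor r y z
even₄-triangle {r = r} even {x} {y} {z} {u} {w} x≢y x≢z y≢z u≢w x≢u x≢w y≢u y≢w z≢u z≢w =
  sym (xor≡false⇒≡ (begin
    (r x y xor r x z xor r y z) xor r u w
      ≡⟨ Bool.xor-identityʳ _ ⟨
    ((r x y xor r x z xor r y z) xor r u w) xor false
      ≡⟨ cong (((r x y xor r x z xor r y z) xor r u w) xor_) (Bool.xor-same D) ⟨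
    ((r x y xor r x z xor r y z) xor r u w) xor (D xor D)
      ≡⟨ solve-xor 10 (λ xy xz yz uw xu xw yu yw zu zw →
           ((xy ⊕ xz ⊕ yz) ⊕ uw) ⊕ ((xu ⊕ xw ⊕ yu ⊕ yw ⊕ zu ⊕ zw ⊕ uw) ⊕ (xu ⊕ xw ⊕ yu ⊕ yw ⊕ zu ⊕ zw ⊕ uw))
             ⊜ (xy ⊕ xu ⊕ xw ⊕ yu ⊕ yw ⊕ uw) ⊕ (xz ⊕ xu ⊕ xw ⊕ zu ⊕ zw ⊕ uw) ⊕ (yz ⊕ yu ⊕ yw ⊕ zu ⊕ zw ⊕ uw))
           refl (r x y) (r x z) (r y z) (r u w) (r x u) (r x w) (r y u) (r y w) (r z u) (r z w) ⟩
    parity₄ r x y u w xor parity₄ r x z u w xor parity₄ r y z u w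
      ≡⟨ cong₂ _xor_ (even (x≢y , x≢u , x≢w , y≢u , y≢w , u≢w))
           (cong₂ _xor_ (even (x≢z , x≢u , x≢w , z≢u , z≢w , u≢w))
                        (even (y≢z , y≢u , y≢w , z≢u , z≢w , u≢w))) ⟩
    false ∎))
  where
  open ≡-Reasoning
  D = r x u xor r x w xor r y u xor r y w xor r z u xor r z w xor r u w

even₄⇒constant : ∀ {r : Fin n → Fin n → Bool} → 7 ≤ n → Even₄ r →
  ∀ {a b c d} → a ≢ b → c ≢ d → r a b ≡ r c d
even₄⇒constant {n} {r} 7≤n even {a} {b} {c} {d} a≢b c≢d
  with fresh (a ∷ b ∷ c ∷ d ∷ []) (ℕ.≤-trans (ℕ.m≤m+n 5 2) 7≤n)
... | x , x≢a ∷ x≢b ∷ x≢c ∷ x≢d ∷ []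
  with fresh (x ∷ a ∷ b ∷ c ∷ d ∷ []) (ℕ.≤-trans (ℕ.m≤m+n 6 1) 7≤n)
... | y , y≢x ∷ y≢a ∷ y≢b ∷ y≢c ∷ y≢d ∷ []
  with fresh (y ∷ x ∷ a ∷ b ∷ c ∷ d ∷ []) 7≤n
... | z , z≢y ∷ z≢x ∷ z≢a ∷ z≢b ∷ z≢c ∷ z≢d ∷ [] = trans
  (even₄-triangle {r = r} even x≢y x≢z y≢z a≢b x≢a x≢b y≢a y≢b z≢a z≢b)
  (sym (even₄-triangle {r = r} even x≢y x≢z y≢z c≢d x≢c x≢d y≢c y≢d z≢c z≢d))
  where
  x≢y = ≢-sym y≢x
  x≢z = ≢-sym z≢x
  y≢z = ≢-sym z≢y

even₄⇒empty-or-complete : ∀ {r : Fin n → Fin n → Bool} → 7 ≤ n → Even₄ r →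
  (∀ {x y} → x ≢ y → r x y ≡ false) ⊎ (∀ {x y} → x ≢ y → r x y ≡ true)
even₄⇒empty-or-complete {n} {r} 7≤n even
  with fresh [] (ℕ.≤-trans (ℕ.m≤m+n 1 6) 7≤n)
... | p , []
  with fresh (p ∷ []) (ℕ.≤-trans (ℕ.m≤m+n 2 5) 7≤n)
... | q , q≢p ∷ [] with r q p in rqp
... | false = inj₁ λ x≢y → trans (even₄⇒constant {r = r} 7≤n even x≢y q≢p) rqp
... | true  = inj₂ λ x≢y → trans (even₄⇒constant {r = r} 7≤n even x≢y q≢p) rqp

-- Odd 4-sets under isomorphism up to complementation

∈-irrelevant : ∀ {K : Subset n} {x} (p q : x ∈ K) → p ≡ q
∈-irrelevant here      here      = refl
∈-irrelevant (there p) (there q) = cong there (∈-irrelevant p q)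

module ExtendByIdentity {n} (K : Subset n) where

  extend : (Elem K → Elem K) → Fin n → Fin n
  extend f x with x ∈? K
  ... | yes x∈K = proj₁ (f (x , x∈K))
  ... | no _    = x

  extend-∈ : ∀ f {x} (x∈K : x ∈ K) → extend f x ≡ proj₁ (f (x , x∈K))
  extend-∈ f {x} x∈K with x ∈? K
  ... | yes x∈K′ = cong (λ p → proj₁ (f (x , p))) (∈-irrelevant x∈K′ x∈K)
  ... | no x∉K   = ⊥-elim (x∉K x∈K)

  extend-inverse : ∀ f g → (∀ e → g (f e) ≡ e) → ∀ x → extend g (extend f x) ≡ x
  extend-inverse f g g∘f x with x ∈? K
  ... | yes x∈K = trans (extend-∈ g (proj₂ (f (x , x∈K)))) (cong proj₁ (g∘f (x , x∈K)))
  ... | no x∉K with x ∈? K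
  ...   | yes x∈K = ⊥-elim (x∉K x∈K)
  ...   | no _    = refl

  extend-preserves : ∀ f x → lookup K (extend f x) ≡ lookup K x
  extend-preserves f x with x ∈? K
  ... | yes x∈K = trans (Vec.[]=⇒lookup (proj₂ (f (x , x∈K)))) (sym (Vec.[]=⇒lookup x∈K))
  ... | no _    = refl

  permutation-of : Elem K ↔ Elem K → Permutation′ n
  permutation-of σ = permutation (extend to) (extend from)
    (extend-inverse from to (λ e → strictlyInverseˡ e)) (extend-inverse to from (λ e → strictlyInverseʳ e))
    where open Inverse σ

oddEdges₄ : Graph n → Vec (Fin n) 4 → ℤ
oddEdges₄ G (a ∷ b ∷ c ∷ d ∷ []) = [ parity₄ (adj G) a b c d ]× 1ℤ

oddEdges₄-symmetric : (G : Graph n) → Symmetric 4 (oddEdges₄ G)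
oddEdges₄-symmetric G =
  (λ { a b (c ∷ d ∷ []) → cong ([_]× 1ℤ) (parity₄-swap₁₂ (adj-sym G) a b c d) }) ,
  λ a → (λ { b c (d ∷ []) → cong ([_]× 1ℤ) (parity₄-swap₂₃ (adj-sym G) a b c d) }) ,
  λ b → (λ { c d [] → cong ([_]× 1ℤ) (parity₄-swap₃₄ (adj-sym G) a b c d) }) ,
  λ _ → tt

oddEdges₄-complement : (G : Graph n) → ∀ w → oddEdges₄ (complement G) w ≡ oddEdges₄ G w
oddEdges₄-complement G (a ∷ b ∷ c ∷ d ∷ []) = cong ([_]× 1ℤ) (parity₄-not (adj G) a b c d)

DistinctIn⇒Distinct₄ : ∀ {K : FinSet n} {a b c d} → DistinctIn K (a ∷ b ∷ c ∷ d ∷ []) →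
  (K a ≡ true × K b ≡ true × K c ≡ true × K d ≡ true) × Distinct₄ a b c d
DistinctIn⇒Distinct₄ {K = K} {a} {b} (Ka , K∖a-b , K∖a∖b-c , K∖a∖b∖c-d , _) =
  (Ka , proj₂ b∉a , proj₂ c∉a , proj₂ d∉a) ,
  (≢-sym (proj₁ b∉a) , ≢-sym (proj₁ c∉a) , ≢-sym (proj₁ d∉a) ,
   ≢-sym (proj₁ c∉b) , ≢-sym (proj₁ d∉b) , ≢-sym (proj₁ d∉c))
  where
  b∉a = ∖-true K K∖a-b
  c∉b = ∖-true (K ∖ a) K∖a∖b-c
  c∉a = ∖-true K (proj₂ c∉b)
  d∉c = ∖-true (K ∖ a ∖ b) K∖a∖b∖c-d
  d∉b = ∖-true (K ∖ a) (proj₂ d∉c)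
  d∉a = ∖-true K (proj₂ d∉b)

Distinct₄⇒DistinctIn-full : ∀ {a b c d : Fin n} → Distinct₄ a b c d →
  DistinctIn full (a ∷ b ∷ c ∷ d ∷ [])
Distinct₄⇒DistinctIn-full (a≢b , a≢c , a≢d , b≢c , b≢d , c≢d) =
  refl ,
  ∖-other full (≢-sym a≢b) ,
  trans (∖-other (full ∖ _) (≢-sym b≢c)) (∖-other full (≢-sym a≢c)) ,
  trans (∖-other (full ∖ _ ∖ _) (≢-sym c≢d))
        (trans (∖-other (full ∖ _) (≢-sym b≢d)) (∖-other full (≢-sym a≢d))) ,
  tt

parity₄-transport : ∀ {K : FinSet n} {r s : Fin n → Fin n → Bool} (f : Fin n → Fin n) →
  (∀ {x y} → K x ≡ true → K y ≡ true → x ≢ y → r x y ≡ s (f x) (f y)) →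
  ∀ {a b c d} → DistinctIn K (a ∷ b ∷ c ∷ d ∷ []) → parity₄ r a b c d ≡ parity₄ s (f a) (f b) (f c) (f d)
parity₄-transport {K = K} f r≡s dw with DistinctIn⇒Distinct₄ {K = K} dw
... | (Ka , Kb , Kc , Kd) , (a≢b , a≢c , a≢d , b≢c , b≢d , c≢d) =
  cong₂ _xor_ (r≡s Ka Kb a≢b) (cong₂ _xor_ (r≡s Ka Kc a≢c) (cong₂ _xor_ (r≡s Ka Kd a≢d)
    (cong₂ _xor_ (r≡s Kb Kc b≢c) (cong₂ _xor_ (r≡s Kb Kd b≢d) (r≡s Kc Kd c≢d)))))

IsoOn⇒equal-sums : ∀ (K : Subset n) (G H : Graph n) → IsoOn K G H →
  sumDistinct 4 (lookup K) (oddEdges₄ G) ≡ sumDistinct 4 (lookup K) (oddEdges₄ H)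
IsoOn⇒equal-sums K G H (σ , σ-iso) = trans
  (sumDistinct-cong 4 (lookup K) {oddEdges₄ G} {oddEdges₄ H ∘ Vec.map (extend to)}
     λ { (a ∷ b ∷ c ∷ d ∷ []) dw → cong ([_]× 1ℤ) (parity₄-transport {r = adj G} {adj H} (extend to) edges dw) })
  (sym (sumDistinct-permute 4 (permutation-of σ) (lookup K) (lookup K) (oddEdges₄ H) (sym ∘ extend-preserves to)))
  where
  open ExtendByIdentity K
  open Inverse σ
  edges : ∀ {x y} → lookup K x ≡ true → lookup K y ≡ true → x ≢ y →
    adj G x y ≡ adj H (extend to x) (extend to y)
  edges {x} {y} Kx Ky x≢y = trans (σ-iso (x , x∈K) (y , y∈K) x≢y)
    (sym (cong₂ (adj H) (extend-∈ to x∈K) (extend-∈ to y∈K)))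
    where
    x∈K = Vec.lookup⇒[]= x K Kx
    y∈K = Vec.lookup⇒[]= y K Ky

IsoUpToCompOn⇒equal-sums : ∀ (K : Subset n) (G H : Graph n) → IsoUpToCompOn K G H →
  sumDistinct 4 (lookup K) (oddEdges₄ G) ≡ sumDistinct 4 (lookup K) (oddEdges₄ H)
IsoUpToCompOn⇒equal-sums K G H (inj₁ G≅H)  = IsoOn⇒equal-sums K G H G≅H
IsoUpToCompOn⇒equal-sums K G H (inj₂ G≅∁H) = trans (IsoOn⇒equal-sums K G (complement H) G≅∁H)
  (sumDistinct-cong 4 (lookup K) λ w _ → oddEdges₄-complement H w)

HypomorphicUpToComp⇒VanishingSums : ∀ {k} (G G′ : Graph n) → HypomorphicUpToComp k G G′ →
  VanishingSums k full 4 (λ w → oddEdges₄ G w - oddEdges₄ G′ w)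
HypomorphicUpToComp⇒VanishingSums G G′ hyp K _ ∣K∣≡k =
  trans (sumDistinct-- 4 K (oddEdges₄ G) (oddEdges₄ G′)) (ℤ.i≡j⇒i-j≡0 (begin
    sumDistinct 4 K (oddEdges₄ G)
      ≡⟨ sumDistinct-congˡ 4 (oddEdges₄ G) (sym ∘ Vec.lookup∘tabulate K) ⟩
    sumDistinct 4 (lookup K′) (oddEdges₄ G)
      ≡⟨ IsoUpToCompOn⇒equal-sums K′ G G′ (hyp K′ (trans (size-tabulate K) ∣K∣≡k)) ⟩
    sumDistinct 4 (lookup K′) (oddEdges₄ G′)
      ≡⟨ sumDistinct-congˡ 4 (oddEdges₄ G′) (Vec.lookup∘tabulate K) ⟩
    sumDistinct 4 K (oddEdges₄ G′) ∎))
  where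
  open ≡-Reasoning
  K′ = tabulate K

same-oddEdges₄⇒even₄ : ∀ (G G′ : Graph n) → (∀ w → DistinctIn full w → oddEdges₄ G w ≡ oddEdges₄ G′ w) →
  Even₄ (λ x y → adj G x y xor adj G′ x y)
same-oddEdges₄⇒even₄ G G′ same {a} {b} {c} {d} distinct = begin
  parity₄ (λ x y → adj G x y xor adj G′ x y) a b c d
    ≡⟨ parity₄-xor (adj G) (adj G′) a b c d ⟩
  p xor parity₄ (adj G′) a b c d
    ≡⟨ cong (p xor_) ([]×1-injective (same _ (Distinct₄⇒DistinctIn-full distinct))) ⟨
  p xor p
    ≡⟨ Bool.xor-same p ⟩
  false ∎
  where
  open ≡-Reasoning
  p = parity₄ (adj G) a b c d

theorem2p5 : (v k : ℕ) → 4 ≤ k → k ≤ v ∸ 4 → (G G′ : Graph v) →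
    HypomorphicUpToComp k G G′ → (G′ ≐ G) ⊎ (G′ ≐ complement G)
theorem2p5 v k 4≤k k≤v∸4 G G′ hyp =
  Sum.map (λ empty    x y x≢y → sym (xor≡false⇒≡ (empty x≢y)))
          (λ complete x y x≢y → xor≡true⇒≡not (complete x≢y))
          (even₄⇒empty-or-complete 7≤v (same-oddEdges₄⇒even₄ G G′ same-oddEdges₄))
  where
  k+4≤v : k ℕ.+ 4 ≤ v
  k+4≤v = ℕ.m≤o∸n⇒m+n≤o k (ℕ.≤-trans 4≤k (ℕ.≤-trans k≤v∸4 (ℕ.m∸n≤m v 4))) k≤v∸4
  7≤v : 7 ≤ v
  7≤v = ℕ.≤-trans (ℕ.n≤1+n 7) (ℕ.≤-trans (ℕ.+-monoˡ-≤ 4 4≤k) k+4≤v)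
  same-oddEdges₄ : ∀ w → DistinctIn full w → oddEdges₄ G w ≡ oddEdges₄ G′ w
  same-oddEdges₄ w dw = ℤ.i-j≡0⇒i≡j _ _
    (vanishing-sums⇒vanishing 4 k full {λ w → oddEdges₄ G w - oddEdges₄ G′ w}
      (Symmetric-- 4 {oddEdges₄ G} {oddEdges₄ G′} (oddEdges₄-symmetric G) (oddEdges₄-symmetric G′)) 4≤k
      (subst (k ℕ.+ 4 ≤_) (sym (size-full v)) k+4≤v)
      (HypomorphicUpToComp⇒VanishingSums G G′ hyp) w dw)
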